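{- Let $G=(V,E,W)$ be a finite connected edge-weighted graph with pairwise distinct edge weights. Run Prim's algorithm on $G$ from an arbitrary seed vertex $v_{seed}$; this yields the (unique) minimal spanning tree $T$ and a unique Prim's order $P$. Let $e_{max}=(v_i,v_j)$ be the longest edge of $T$. Removing $e_{max}$ from $T$ splits $T$ into two subtrees. Then these two subtrees are $T_L=(V_L,E_L)$ and $T_R=(V_R,E_R)$, where \[ V_L=\{v\in V: P(v)<P(e_{max})\},\qquad V_R=\{v\in V: P(v)\ge P(e_{max})\}, \] \[ E_L=\{e \text{ edge of } T: P(e)<P(e_{max})\},\qquad E_R=\{e \text{ edge of } T: P(e)>P(e_{max})\}, \] with $P(e_{max})=\max(P(v_i),P(v_j))$.
   Context: Prim's algorithm on a connected edge-weighted graph $G=(V,E,W)$: choose a seed vertex $v_{seed}$, set $V_{mst}=\{v_{seed}\}$, $E_{mst}=\emptyset$; while $V_{mst}\neq V$, pick an edge $(u,v)$ with $u\in V_{mst}$, $v\notin V_{mst}$ minimizing $W(u,v)$, and add $v$ to $V_{mst}$ and $(u,v)$ to $E_{mst}$. The output $(V,E_{mst})$ is a minimal spanning tree. The Prim's order is the order in which vertices are added to $V_{mst}$: $P(v)$ is the position of $v$, with $P(v_{seed})=1$. For an edge $e=(v_i,v_j)$ of the minimal spanning tree, $P(e)=\max(P(v_i),P(v_j))$. -}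

module Defs where

open import Level using (Level; _⊔_) renaming (suc to lsuc; zero to lzero)
open import Data.Nat using (ℕ; suc; _<_; _≤_) renaming (_⊔_ to _⊔ℕ_)
open import Data.Fin using (Fin; toℕ) renaming (_<_ to _<ᶠ_)
open import Data.Product using (Σ; ∃; _×_; _,_)
open import Data.Sum using (_⊎_)
open import Relation.Nullary using (¬_)
open import Relation.Binary.PropositionalEquality using (_≡_; _≢_)
open import Relation.Binary.Bundles using (StrictTotalOrder)
open import Relation.Binary.Construct.Closure.ReflexiveTransitive using (Star)
open import Function.Bundles using (_⇔_)

-- Weights live in an arbitrary strict total order (e.g. ℕ, ℚ, ℝ):
-- Prim's algorithm and the statement only use comparisons of weights.
module _ {a ℓ₁ ℓ₂ : Level} (S : StrictTotalOrder a ℓ₁ ℓ₂) where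
  open StrictTotalOrder S renaming (Carrier to Wt; _<_ to _<w_)

  record WGraph (n : ℕ) : Set (lsuc lzero ⊔ a ⊔ ℓ₁) where
    field
      Adj        : Fin n → Fin n → Set
      Adj-sym    : ∀ {u v} → Adj u v → Adj v u
      Adj-irrefl : ∀ {u} → ¬ Adj u u
      W          : Fin n → Fin n → Wt
      W-sym      : ∀ u v → W u v ≈ W v u

  module _ {n : ℕ} (G : WGraph n) where
    open WGraph G

    SameEdge : Fin n → Fin n → Fin n → Fin n → Set
    SameEdge u v x y = (u ≡ x × v ≡ y) ⊎ (u ≡ y × v ≡ x)

    Connected : Set
    Connected = ∀ u v → Star Adj u v

    DistinctWeights : Set ℓ₁
    DistinctWeights = ∀ u v x y → Adj u v → Adj x y → W u v ≈ W x y → SameEdge u v x y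

    -- A run of Prim's algorithm from the seed vertex.
    -- ord k : the vertex added at step k (0-indexed; step 0 is the seed),
    -- pos   : its inverse.  At step k > 0 the chosen edge is (ord (par k), ord k),
    -- with ord (par k) already in V_mst = {ord i | i < k}, ord k not in V_mst,
    -- and no edge from V_mst to V ∖ V_mst has strictly smaller weight.
    record PrimRun (seed : Fin n) : Set ℓ₂ where
      field
        ord      : Fin n → Fin n
        pos      : Fin n → Fin n
        ord-pos  : ∀ v → ord (pos v) ≡ v
        pos-ord  : ∀ k → pos (ord k) ≡ k
        pos-seed : toℕ (pos seed) ≡ 0
        par      : Fin n → Fin n
        par-lt   : ∀ k → 0 < toℕ k → par k <ᶠ k
        par-adj  : ∀ k → 0 < toℕ k → Adj (ord (par k)) (ord k)
        par-min  : ∀ k → 0 < toℕ k → ∀ x y → Adj x y →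
                   (∃ λ i → i <ᶠ k × ord i ≡ x) →
                   (∀ i → i <ᶠ k → ord i ≢ y) →
                   ¬ (W x y <w W (ord (par k)) (ord k))

    module _ {seed : Fin n} (R : PrimRun seed) where
      open PrimRun R

      -- Prim's order, 1-indexed: P(seed) = 1
      P : Fin n → ℕ
      P v = suc (toℕ (pos v))

      Pₑ : Fin n → Fin n → ℕ
      Pₑ u v = P u ⊔ℕ P v

      TEdge : Fin n → Fin n → Set
      TEdge u v = ∃ λ k → 0 < toℕ k × SameEdge (ord (par k)) (ord k) u v

      Longest : Fin n → Fin n → Set ℓ₂
      Longest x y = TEdge x y × (∀ u v → TEdge u v → ¬ (W x y <w W u v))

      TEdge∖ : Fin n → Fin n → Fin n → Fin n → Set
      TEdge∖ x y u v = TEdge u v × ¬ SameEdge u v x y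

      record Split (x y : Fin n) : Set where
        field
          L-connected : ∀ u v → P u < Pₑ x y → P v < Pₑ x y → Star (TEdge∖ x y) u v
          R-connected : ∀ u v → Pₑ x y ≤ P u → Pₑ x y ≤ P v → Star (TEdge∖ x y) u v
          separated   : ∀ u v → P u < Pₑ x y → Pₑ x y ≤ P v → ¬ Star (TEdge∖ x y) u v
          L-edges     : ∀ u v → (TEdge∖ x y u v × P u < Pₑ x y × P v < Pₑ x y)
                                ⇔ (TEdge u v × Pₑ u v < Pₑ x y)
          R-edges     : ∀ u v → (TEdge∖ x y u v × Pₑ x y ≤ P u × Pₑ x y ≤ P v)
                                ⇔ (TEdge u v × Pₑ x y < Pₑ u v)

module Submission where

-- Number the Prim steps 0,1,…,n-1, so that P(ord k) = k+1 and the
-- tree edge added at step k > 0 is (ord (par k), ord k), whose Prim position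
-- is k+1.  Let e_max be added at step K; then P(e_max) = K+1, so V_L is the set
-- of vertices added before step K and V_R the set added at or after step K.
--
-- The theorem follows: descending parent chains connects V_L to the seed and
-- V_R to ord K; edges of T ∖ e_max never cross, so V_L and V_R are separated;
-- and the edge sets are recognised by comparing Prim positions with K+1.

open import Defs
open import Level using (Level)
open import Data.Nat using (ℕ; suc; _<_; _≤_; _⊔_; z≤n; s≤s)
open import Data.Nat.Properties hiding (_≟_)
open import Data.Fin using (Fin; toℕ; _≟_) renaming (_<_ to _<ᶠ_)
open import Data.Fin.Properties using (toℕ-injective)
open import Data.Fin.Induction using (<-wellFounded)
open import Data.Product using (_×_; _,_; proj₁)
open import Data.Sum using (_⊎_; inj₁; inj₂)
open import Data.Empty using (⊥-elim)
open import Function using (id)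
open import Induction.WellFounded using (Acc; acc)
open import Relation.Nullary using (¬_; yes; no)
open import Relation.Binary.PropositionalEquality
open import Relation.Binary.Bundles using (StrictTotalOrder)
open import Relation.Binary.Definitions using (Symmetric; tri<; tri≈; tri>)
open import Relation.Binary.Construct.Closure.ReflexiveTransitive
  using (Star; ε; _◅_; _◅◅_; fold; reverse)
open import Function.Bundles using (_⇔_; mk⇔)

preserved-along : ∀ {A : Set} {_~_ : A → A → Set} (Q : A → Set) →
                  (∀ {u v} → u ~ v → Q u → Q v) → ∀ {u v} → Star _~_ u v → Q u → Q v
preserved-along Q step = fold (λ u v → Q u → Q v) (λ e k q → k (step e q)) id

module UnorderedPairs {a ℓ₁ ℓ₂ : Level} (S : StrictTotalOrder a ℓ₁ ℓ₂)
                      {n : ℕ} (G : WGraph S n) where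
  open StrictTotalOrder S using (_≈_; module Eq)
  open WGraph G

  sameEdge-sym : ∀ {u v x y} → SameEdge S G u v x y → SameEdge S G x y u v
  sameEdge-sym (inj₁ (refl , refl)) = inj₁ (refl , refl)
  sameEdge-sym (inj₂ (refl , refl)) = inj₂ (refl , refl)

  sameEdge-trans : ∀ {u v x y s t} → SameEdge S G u v x y → SameEdge S G x y s t →
                   SameEdge S G u v s t
  sameEdge-trans (inj₁ (refl , refl)) e = e
  sameEdge-trans (inj₂ (refl , refl)) (inj₁ (refl , refl)) = inj₂ (refl , refl)
  sameEdge-trans (inj₂ (refl , refl)) (inj₂ (refl , refl)) = inj₁ (refl , refl)

  sameEdge-swap : ∀ {u v x y} → SameEdge S G u v x y → SameEdge S G v u x y
  sameEdge-swap (inj₁ (refl , refl)) = inj₂ (refl , refl)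
  sameEdge-swap (inj₂ (refl , refl)) = inj₁ (refl , refl)

  sameEdge-W : ∀ {u v x y} → SameEdge S G u v x y → W u v ≈ W x y
  sameEdge-W (inj₁ (refl , refl)) = Eq.refl
  sameEdge-W (inj₂ (refl , refl)) = W-sym _ _

  sameEdge-ends : ∀ {ℓ} (Q : Fin n → Set ℓ) {u v x y} → Q u → Q v →
                  SameEdge S G u v x y → Q x × Q y
  sameEdge-ends Q qu qv (inj₁ (refl , refl)) = qu , qv
  sameEdge-ends Q qu qv (inj₂ (refl , refl)) = qv , qu

module PrimRunFacts {a ℓ₁ ℓ₂ : Level} (S : StrictTotalOrder a ℓ₁ ℓ₂)
                    {n : ℕ} (G : WGraph S n) {seed : Fin n} (R : PrimRun S G seed) where
  open UnorderedPairs S G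
  open PrimRun R

  sameEdge-Pₑ : ∀ {u v x y} → SameEdge S G u v x y → Pₑ S G R u v ≡ Pₑ S G R x y
  sameEdge-Pₑ (inj₁ (refl , refl)) = refl
  sameEdge-Pₑ {u} {v} (inj₂ (refl , refl)) = ⊔-comm (P S G R u) (P S G R v)

  ord-injective : ∀ {i k} → ord i ≡ ord k → i ≡ k
  ord-injective {i} {k} e = trans (sym (pos-ord i)) (trans (cong pos e) (pos-ord k))

  P-ord : ∀ k → P S G R (ord k) ≡ suc (toℕ k)
  P-ord k = cong (λ i → suc (toℕ i)) (pos-ord k)

  -- the edge added at step k > 0 has Prim position k+1, its parent being older
  Pₑ-step : ∀ k → 0 < toℕ k → Pₑ S G R (ord (par k)) (ord k) ≡ suc (toℕ k)
  Pₑ-step k k>0 = trans (cong₂ _⊔_ (P-ord (par k)) (P-ord k))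
                        (m≤n⇒m⊔n≡n (<⇒≤ (s≤s (par-lt k k>0))))

  treeEdge-Pₑ : ∀ {u v} (t : TEdge S G R u v) → Pₑ S G R u v ≡ suc (toℕ (proj₁ t))
  treeEdge-Pₑ (k , k>0 , s) = trans (sym (sameEdge-Pₑ s)) (Pₑ-step k k>0)

  step-from-Pₑ : ∀ {u v x y} (t : TEdge S G R u v) (t′ : TEdge S G R x y) →
                 Pₑ S G R u v ≡ Pₑ S G R x y → proj₁ t ≡ proj₁ t′
  step-from-Pₑ t t′ Pₑ≡ =
    toℕ-injective (suc-injective (trans (sym (treeEdge-Pₑ t)) (trans Pₑ≡ (treeEdge-Pₑ t′))))

  Pₑ-determines-treeEdge : ∀ {u v x y} → TEdge S G R u v → TEdge S G R x y →
                           Pₑ S G R u v ≡ Pₑ S G R x y → SameEdge S G u v x y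
  Pₑ-determines-treeEdge t@(_ , _ , sj) t′@(_ , _ , sk) Pₑ≡ with step-from-Pₑ t t′ Pₑ≡
  ... | refl = sameEdge-trans (sameEdge-sym sj) sk

  parentEdge : ∀ k → 0 < toℕ k → TEdge S G R (ord k) (ord (par k))
  parentEdge k k>0 = k , k>0 , inj₂ (refl , refl)

  module Descent {_~_ : Fin n → Fin n → Set} (Q : Fin n → Set) (b : Fin n)
                 (climb : ∀ i → Q i → i ≢ b →
                          0 < toℕ i × Q (par i) × ord i ~ ord (par i)) where

    descend : ∀ i → Q i → Star _~_ (ord i) (ord b)
    descend i = go i (<-wellFounded i)
      where
      go : ∀ i → Acc _<ᶠ_ i → Q i → Star _~_ (ord i) (ord b)
      go i (acc rs) qi with i ≟ b
      ... | yes refl = ε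
      ... | no i≢b with climb i qi i≢b
      ...   | i>0 , qp , edge = edge ◅ go (par i) (rs (par-lt i i>0)) qp

    connected : Symmetric _~_ →
                ∀ u v → Q (pos u) → Q (pos v) → Star _~_ u v
    connected sym~ u v qu qv = subst₂ (Star _~_) (ord-pos u) (ord-pos v)
      (descend (pos u) qu ◅◅ reverse sym~ (descend (pos v) qv))

module LongestEdge {a ℓ₁ ℓ₂ : Level} (S : StrictTotalOrder a ℓ₁ ℓ₂)
                   {n : ℕ} (G : WGraph S n) (distinct : DistinctWeights S G)
                   {seed : Fin n} (R : PrimRun S G seed) (x y : Fin n)
                   (K : Fin n) (K>0 : 0 < toℕ K)
                   (K-is-xy : SameEdge S G (PrimRun.ord R (PrimRun.par R K)) (PrimRun.ord R K) x y)
                   (longest : ∀ u v → TEdge S G R u v →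
                              ¬ (StrictTotalOrder._<_ S (WGraph.W G x y) (WGraph.W G u v)))
                   where
  open StrictTotalOrder S using (compare; <-respˡ-≈) renaming (_<_ to _<w_)
  open WGraph G
  open PrimRun R
  open UnorderedPairs S G
  open PrimRunFacts S G R

  xy-tree : TEdge S G R x y
  xy-tree = K , K>0 , K-is-xy

  cut : Pₑ S G R x y ≡ suc (toℕ K)
  cut = treeEdge-Pₑ xy-tree

  lighter : ∀ j → 0 < toℕ j → j ≢ K → W (ord (par j)) (ord j) <w W (ord (par K)) (ord K)
  lighter j j>0 j≢K with compare (W (ord (par j)) (ord j)) (W (ord (par K)) (ord K))
  ... | tri< lt _ _ = lt
  ... | tri≈ _ eq _ = ⊥-elim (j≢K (step-from-Pₑ (j , j>0 , same) (K , K>0 , inj₁ (refl , refl)) refl))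
    where same = distinct _ _ _ _ (par-adj j j>0) (par-adj K K>0) eq
  ... | tri> _ _ gt = ⊥-elim (longest _ _ (j , j>0 , inj₁ (refl , refl))
                                (<-respˡ-≈ (sameEdge-W K-is-xy) gt))

  -- Otherwise its parent edge would leave V_mst at step K and be
  -- lighter than e_max, contradicting the minimal choice made at step K.
  laterStepsStayRight : ∀ j → toℕ K < toℕ j → toℕ K ≤ toℕ (par j)
  laterStepsStayRight j K<j = ≮⇒≥ λ parj<K →
    par-min K K>0 (ord (par j)) (ord j) (par-adj j j>0) (par j , parj<K , refl)
            (λ i i<K ordi≡ordj → <-irrefl (cong toℕ (ord-injective ordi≡ordj)) (<-trans i<K K<j))
            (lighter j j>0 (λ j≡K → <-irrefl (cong toℕ (sym j≡K)) K<j))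
    where
    j>0 : 0 < toℕ j
    j>0 = ≤-<-trans z≤n K<j

  _—_ : Fin n → Fin n → Set
  _—_ = TEdge∖ S G R x y

  —-sym : Symmetric _—_
  —-sym ((j , j>0 , s) , s≢xy) =
    (j , j>0 , sameEdge-sym (sameEdge-swap (sameEdge-sym s))) , λ s' → s≢xy (sameEdge-swap s')

  offCut : ∀ {u v} → TEdge S G R u v → Pₑ S G R u v ≢ Pₑ S G R x y → u — v
  offCut t Pₑ≢ = t , λ s → Pₑ≢ (sameEdge-Pₑ s)

  onCut : ∀ {u v} → u — v → Pₑ S G R u v ≢ Pₑ S G R x y
  onCut (t , s≢xy) Pₑ≡ = s≢xy (Pₑ-determines-treeEdge t xy-tree Pₑ≡)

  Left Right : Fin n → Set
  Left v = P S G R v < Pₑ S G R x y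
  Right v = Pₑ S G R x y ≤ P S G R v

  left-step : ∀ {i} → toℕ i < toℕ K → Left (ord i)
  left-step {i} i<K = subst₂ _<_ (sym (P-ord i)) (sym cut) (s≤s i<K)

  right-step : ∀ {i} → toℕ K ≤ toℕ i → Right (ord i)
  right-step {i} K≤i = subst₂ _≤_ (sym cut) (sym (P-ord i)) (s≤s K≤i)

  edge-sides : ∀ {u v} → u — v → (Left u × Left v) ⊎ (Right u × Right v)
  edge-sides ((j , j>0 , s) , s≢xy) with <-cmp (toℕ j) (toℕ K)
  ... | tri< j<K _ _ =
    inj₁ (sameEdge-ends Left (left-step (<-trans (par-lt j j>0) j<K)) (left-step j<K) s)
  ... | tri≈ _ j≡K _ with toℕ-injective j≡K
  ...   | refl = ⊥-elim (s≢xy (sameEdge-trans (sameEdge-sym s) K-is-xy))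
  edge-sides ((j , j>0 , s) , _) | tri> _ _ K<j =
    inj₂ (sameEdge-ends Right (right-step (laterStepsStayRight j K<j)) (right-step (<⇒≤ K<j)) s)

  parentEdge∖ : ∀ i → 0 < toℕ i → i ≢ K → ord i — ord (par i)
  parentEdge∖ i i>0 i≢K =
    offCut (parentEdge i i>0) λ Pₑ≡ → i≢K (step-from-Pₑ (parentEdge i i>0) xy-tree Pₑ≡)

  climbLeft : ∀ i → toℕ i < toℕ K → i ≢ pos seed →
              0 < toℕ i × toℕ (par i) < toℕ K × ord i — ord (par i)
  climbLeft i i<K i≢seed = i>0 , <-trans (par-lt i i>0) i<K ,
                           parentEdge∖ i i>0 λ i≡K → <-irrefl (cong toℕ i≡K) i<K
    where
    i>0 : 0 < toℕ i
    i>0 = n≢0⇒n>0 λ i≡0 → i≢seed (toℕ-injective (trans i≡0 (sym pos-seed)))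

  climbRight : ∀ i → toℕ K ≤ toℕ i → i ≢ K →
               0 < toℕ i × toℕ K ≤ toℕ (par i) × ord i — ord (par i)
  climbRight i K≤i i≢K = i>0 , laterStepsStayRight i K<i , parentEdge∖ i i>0 i≢K
    where
    K<i : toℕ K < toℕ i
    K<i = ≤∧≢⇒< K≤i λ K≡i → i≢K (toℕ-injective (sym K≡i))
    i>0 : 0 < toℕ i
    i>0 = ≤-<-trans z≤n K<i

  module DescentLeft  = Descent {_~_ = _—_} (λ i → toℕ i < toℕ K) (pos seed) climbLeft
  module DescentRight = Descent {_~_ = _—_} (λ i → toℕ K ≤ toℕ i) K climbRight

  unLeft : ∀ {v} → Left v → toℕ (pos v) < toℕ K
  unLeft {v} lv = ≤-pred (subst (P S G R v <_) cut lv)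

  unRight : ∀ {v} → Right v → toℕ K ≤ toℕ (pos v)
  unRight {v} rv = ≤-pred (subst (_≤ P S G R v) cut rv)

  stayLeft : ∀ {u v} → Star _—_ u v → Left u → Left v
  stayLeft = preserved-along Left step
    where
    step : ∀ {u v} → u — v → Left u → Left v
    step e lu with edge-sides e
    ... | inj₁ (_ , lv) = lv
    ... | inj₂ (ru , _) = ⊥-elim (<⇒≱ lu ru)

  left-edges : ∀ u v → (u — v × Left u × Left v) ⇔ (TEdge S G R u v × Pₑ S G R u v < Pₑ S G R x y)
  left-edges u v = mk⇔
    (λ { (e , lu , lv) → proj₁ e , ⊔-lub lu lv })
    (λ { (t , lt) → offCut t (<⇒≢ lt) ,
                    ≤-<-trans (m≤m⊔n (P S G R u) (P S G R v)) lt ,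
                    ≤-<-trans (m≤n⊔m (P S G R u) (P S G R v)) lt })

  right-edges : ∀ u v → (u — v × Right u × Right v) ⇔ (TEdge S G R u v × Pₑ S G R x y < Pₑ S G R u v)
  right-edges u v = mk⇔
    (λ { (e , ru , _) → proj₁ e ,
           ≤∧≢⇒< (≤-trans ru (m≤m⊔n (P S G R u) (P S G R v))) (λ eq → onCut e (sym eq)) })
    (λ { (t , gt) → bothRight (offCut t (>⇒≢ gt)) gt })
    where
    bothRight : u — v → Pₑ S G R x y < Pₑ S G R u v → u — v × Right u × Right v
    bothRight e gt with edge-sides e
    ... | inj₁ (lu , lv) = ⊥-elim (<⇒≱ gt (<⇒≤ (⊔-lub lu lv)))
    ... | inj₂ sides = e , sides

  split : Split S G R x y
  split = record
    { L-connected = λ u v lu lv → DescentLeft.connected —-sym u v (unLeft lu) (unLeft lv)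
    ; R-connected = λ u v ru rv → DescentRight.connected —-sym u v (unRight ru) (unRight rv)
    ; separated   = λ u v lu rv path → <⇒≱ (stayLeft path lu) rv
    ; L-edges     = left-edges
    ; R-edges     = right-edges
    }

proposition1 : ∀ {a ℓ₁ ℓ₂ : Level} (S : StrictTotalOrder a ℓ₁ ℓ₂) (n : ℕ) (G : WGraph S n) →
    Connected S G → DistinctWeights S G →
    (seed : Fin n) (R : PrimRun S G seed) (x y : Fin n) →
    Longest S G R x y → Split S G R x y
proposition1 S n G _ distinct seed R x y ((K , K>0 , K-is-xy) , longest) =
  LongestEdge.split S G distinct R x y K K>0 K-is-xy longest
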